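{- Every $\alpha_0^{+}$-stable finite simple graph is $\alpha_{P_3}^{+}$-stable.
   Context: $\alpha(G)$ is the maximum size of a stable set; $\Omega(G)$ is the set of maximum stable sets; $\xi(G)=|\bigcap\{S:S\in\Omega(G)\}|$. $G$ is $\alpha_0^{+}$-stable if $\xi(G)=0$. For $e\in E(\overline{G})$ (a pair of distinct non-adjacent vertices), $G+e$ denotes $G$ with $e$ added. $G$ is $\alpha_{P_3}^{+}$-stable if $\alpha(G+e_1+e_2)=\alpha(G)$ for any $e_1,e_2\in E(\overline{G})$ (not necessarily distinct) having a common endpoint. -}

module Defs where

open import Data.Nat using (ℕ; _≤_)
open import Data.Bool using (Bool; true; false; _∨_; _∧_)
open import Data.Bool.Properties using (∨-comm)
open import Data.Empty using (⊥-elim)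
open import Data.Fin using (Fin; _≟_)
open import Data.Fin.Subset using (Subset; _∈_; _∉_; ∣_∣)
open import Data.Product using (Σ; _×_; _,_)
open import Relation.Nullary using (¬_; yes; no)
open import Relation.Nullary.Decidable using (⌊_⌋)
open import Relation.Binary.PropositionalEquality using (_≡_; _≢_; refl; cong₂; sym; trans)

record Graph (n : ℕ) : Set where
  field
    adj    : Fin n → Fin n → Bool
    symm   : ∀ x y → adj x y ≡ adj y x
    irrefl : ∀ x → adj x x ≡ false
open Graph public

isPair : ∀ {n} → Fin n → Fin n → Fin n → Fin n → Bool
isPair u v x y = ⌊ x ≟ u ⌋ ∧ ⌊ y ≟ v ⌋

NonEdge : ∀ {n} → Graph n → Fin n → Fin n → Set
NonEdge G u v = (u ≢ v) × (adj G u v ≡ false)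

private
  isPair-diag : ∀ {n} (u v x : Fin n) → u ≢ v → isPair u v x x ≡ false
  isPair-diag u v x u≢v with x ≟ u | x ≟ v
  ... | yes refl | yes refl = ⊥-elim (u≢v refl)
  ... | yes _    | no _     = refl
  ... | no _     | _        = refl

addEdge : ∀ {n} (G : Graph n) (u v : Fin n) → u ≢ v → Graph n
addEdge G u v u≢v = record
  { adj    = λ x y → adj G x y ∨ (isPair u v x y ∨ isPair u v y x)
  ; symm   = λ x y → cong₂ _∨_ (symm G x y) (∨-comm (isPair u v x y) (isPair u v y x))
  ; irrefl = λ x → irr x
  }
  where
  irr : ∀ x → adj G x x ∨ (isPair u v x x ∨ isPair u v x x) ≡ false
  irr x rewrite irrefl G x | isPair-diag u v x u≢v = refl

Stable : ∀ {n} → Graph n → Subset n → Set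
Stable G S = ∀ x y → x ∈ S → y ∈ S → adj G x y ≡ false

IsAlpha : ∀ {n} → Graph n → ℕ → Set
IsAlpha G k = Σ (Subset _) (λ S → Stable G S × ∣ S ∣ ≡ k)
            × (∀ T → Stable G T → ∣ T ∣ ≤ k)

MaxStable : ∀ {n} → Graph n → Subset n → Set
MaxStable G S = Stable G S × (∀ T → Stable G T → ∣ T ∣ ≤ ∣ S ∣)

InCore : ∀ {n} → Graph n → Fin n → Set
InCore G v = ∀ S → MaxStable G S → v ∈ S

Alpha0Stable : ∀ {n} → Graph n → Set
Alpha0Stable G = ∀ v → ¬ InCore G v

-- α(G + e₁ + e₂) = α(G) for all e₁ = uv, e₂ = uw in E(Ḡ) with common
-- endpoint u (v = w allowed, i.e. e₁ = e₂ allowed).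
AlphaP3Stable : ∀ {n} → Graph n → Set
AlphaP3Stable {n} G =
  ∀ (u v w : Fin n) (e₁ : NonEdge G u v) (e₂ : NonEdge G u w) (k : ℕ) →
  IsAlpha G k →
  IsAlpha (addEdge (addEdge G u v (Data.Product.proj₁ e₁)) u w (Data.Product.proj₁ e₂)) k

{-# OPTIONS --safe #-}
-- Every edge added in G + uv + uw contains u, so a stable set avoiding u
-- stays stable, while adding edges can never enlarge a stable set.  As u
-- is not in core(G), some maximum stable set of G avoids u; it is then a
-- stable set of size α(G) in G + uv + uw.
module Submission where

open import Data.Bool using (false)
import Data.Bool.Properties as Bool
open import Data.Empty using (⊥-elim)
open import Data.Fin using (Fin; _≟_)
open import Data.Fin.Properties using (all?)
open import Data.Fin.Subset using (Subset; _∈_; _∉_; ∣_∣)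
open import Data.Fin.Subset.Properties using (anySubset?; _∈?_)
open import Data.Nat using (ℕ; _≤_)
import Data.Nat.Properties as ℕ
open import Data.Product using (∃; _×_; _,_)
open import Relation.Nullary using (¬_; yes; no; Dec)
open import Relation.Nullary.Decidable using (_→-dec_; _×-dec_; ¬?)
open import Relation.Binary.PropositionalEquality using (_≡_; _≢_; refl; subst)
open import Defs

private
  variable
    n k : ℕ

stable? : (G : Graph n) (S : Subset n) → Dec (Stable G S)
stable? G S = all? λ x → all? λ y →
  (x ∈? S) →-dec ((y ∈? S) →-dec (adj G x y Bool.≟ false))

isPair-≢ : (u v x y : Fin n) → x ≢ u → isPair u v x y ≡ false
isPair-≢ u v x y x≢u with x ≟ u
... | yes x≡u = ⊥-elim (x≢u x≡u)
... | no _    = refl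

∈∧∉⇒≢ : {S : Subset n} {x y : Fin n} → x ∈ S → y ∉ S → x ≢ y
∈∧∉⇒≢ x∈S y∉S refl = y∉S x∈S

addEdge-adj-≢ : (G : Graph n) {u v : Fin n} (u≢v : u ≢ v) {x y : Fin n} →
                x ≢ u → y ≢ u → adj (addEdge G u v u≢v) x y ≡ adj G x y
addEdge-adj-≢ G {u} {v} _ {x} {y} x≢u y≢u
  rewrite isPair-≢ u v x y x≢u | isPair-≢ u v y x y≢u = Bool.∨-identityʳ (adj G x y)

Stable-addEdge⁻ : (G : Graph n) {u v : Fin n} (u≢v : u ≢ v) {S : Subset n} →
                  Stable (addEdge G u v u≢v) S → Stable G S
Stable-addEdge⁻ G _ stable x y x∈S y∈S = Bool.∨-conicalˡ _ _ (stable x y x∈S y∈S)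

Stable-addEdge⁺ : (G : Graph n) {u v : Fin n} (u≢v : u ≢ v) {S : Subset n} →
                  u ∉ S → Stable G S → Stable (addEdge G u v u≢v) S
Stable-addEdge⁺ G u≢v u∉S stable x y x∈S y∈S
  rewrite addEdge-adj-≢ G u≢v (∈∧∉⇒≢ x∈S u∉S) (∈∧∉⇒≢ y∈S u∉S) = stable x y x∈S y∈S

stableBound-addEdge : (G : Graph n) {u v : Fin n} (u≢v : u ≢ v) →
                      (∀ T → Stable G T → ∣ T ∣ ≤ k) →
                      ∀ T → Stable (addEdge G u v u≢v) T → ∣ T ∣ ≤ k
stableBound-addEdge G u≢v bound T stable = bound T (Stable-addEdge⁻ G u≢v stable)

MaxStable⇒∣S∣≡α : (G : Graph n) → IsAlpha G k →
                  ∀ {S} → MaxStable G S → ∣ S ∣ ≡ k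
MaxStable⇒∣S∣≡α G ((S₀ , stable₀ , ∣S₀∣≡k) , bound) {S} (stable , maximum) =
  ℕ.≤-antisym (bound S stable) (subst (_≤ ∣ S ∣) ∣S₀∣≡k (maximum S₀ stable₀))

-- Constructively, a maximum stable set avoiding u is found by exhaustive
-- search over the finitely many subsets.
¬InCore⇒avoidingMaxStable : (G : Graph n) → IsAlpha G k → ∀ {u} → ¬ InCore G u →
                            ∃ λ S → Stable G S × ∣ S ∣ ≡ k × u ∉ S
¬InCore⇒avoidingMaxStable {k = k} G α {u} u∉core
  with anySubset? (λ S → stable? G S ×-dec ((∣ S ∣ ℕ.≟ k) ×-dec ¬? (u ∈? S)))
... | yes found = found
... | no none   = ⊥-elim (u∉core inCore)
  where
  inCore : InCore G u
  inCore S max@(stable , _) with u ∈? S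
  ... | yes u∈S = u∈S
  ... | no u∉S  = ⊥-elim (none (S , stable , MaxStable⇒∣S∣≡α G α max , u∉S))

proposition3 : ∀ (n : ℕ) (G : Graph n) → Alpha0Stable G → AlphaP3Stable G
proposition3 n G ξ≡0 u v w (u≢v , _) (u≢w , _) k α@(_ , bound)
  with ¬InCore⇒avoidingMaxStable G α (ξ≡0 u)
... | S , stable , ∣S∣≡k , u∉S =
  (S , Stable-addEdge⁺ G₁ u≢w u∉S (Stable-addEdge⁺ G u≢v u∉S stable) , ∣S∣≡k) ,
  stableBound-addEdge G₁ u≢w (stableBound-addEdge G u≢v bound)
  where
  G₁ = addEdge G u v u≢v
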